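{- Let $T$ be a tree with radius $rad(T)$. Then $vcfc(T)\le rad(T)+1$. Moreover, the bound is sharp: every star $T$ of order at least two satisfies $vcfc(T)=2=rad(T)+1$.
   Context: The eccentricity of a vertex $v$ is the maximum distance from $v$ to the other vertices; the radius $rad(G)$ is the minimum eccentricity over all vertices. Vertex-colorings are arbitrary, not necessarily proper. A path in a vertex-colored graph is called conflict-free if there is a color used on exactly one of its vertices. A vertex-colored graph is conflict-free vertex-connected if any two vertices of the graph are connected by a conflict-free path. For a connected graph $G$, the conflict-free vertex-connection number $vcfc(G)$ is the smallest number of colors needed in a vertex-coloring of $G$ that makes $G$ conflict-free vertex-connected. -}

module Defs where

open import Data.Nat using (ℕ; zero; suc; _≤_; _<_)
open import Data.Fin using (Fin; _≟_)
open import Data.Bool using (Bool; T)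
open import Data.List using (List; []; _∷_; length; filter)
open import Data.List.Relation.Unary.Unique.Propositional using (Unique)
open import Data.Product using (Σ; ∃; ∃-syntax; _×_; _,_)
open import Data.Sum using (_⊎_)
open import Relation.Nullary using (¬_)
open import Relation.Binary.PropositionalEquality using (_≡_; _≢_)

record Graph (n : ℕ) : Set where
  field
    adj    : Fin n → Fin n → Bool
    sym    : ∀ x y → T (adj x y) → T (adj y x)
    irrefl : ∀ x → ¬ T (adj x x)
open Graph public

Adj : ∀ {n} → Graph n → Fin n → Fin n → Set
Adj G x y = T (adj G x y)

data Walk {n : ℕ} (G : Graph n) : Fin n → Fin n → List (Fin n) → Set where
  here : ∀ {u} → Walk G u u (u ∷ [])
  step : ∀ {u w v xs} → Adj G u w → Walk G w v xs → Walk G u v (u ∷ xs)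

Path : ∀ {n} → Graph n → Fin n → Fin n → List (Fin n) → Set
Path G u v xs = Walk G u v xs × Unique xs

Connected : ∀ {n} → Graph n → Set
Connected {n} G = ∀ (u v : Fin n) → ∃[ xs ] Walk G u v xs

Acyclic : ∀ {n} → Graph n → Set
Acyclic {n} G = ∀ (x y : Fin n) (xs : List (Fin n)) →
  Path G x y xs → 3 ≤ length xs → ¬ Adj G y x

IsTree : ∀ {n} → Graph n → Set
IsTree {n} G = 1 ≤ n × Connected G × Acyclic G

-- d is the distance from u to v (number of edges of a shortest u-v path).
IsDist : ∀ {n} → Graph n → Fin n → Fin n → ℕ → Set
IsDist G u v d =
  (∃[ xs ] (Path G u v xs × length xs ≡ suc d)) ×
  (∀ xs → Path G u v xs → suc d ≤ length xs)

-- e is the eccentricity of v (graph assumed connected).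
IsEcc : ∀ {n} → Graph n → Fin n → ℕ → Set
IsEcc {n} G v e = (∀ (u : Fin n) d → IsDist G v u d → d ≤ e) × (∃[ u ] IsDist G v u e)

IsRadius : ∀ {n} → Graph n → ℕ → Set
IsRadius {n} G r = (∃[ v ] IsEcc G v r) × (∀ (v : Fin n) e → IsEcc G v e → r ≤ e)

ConflictFree : ∀ {n k} → (Fin n → Fin k) → List (Fin n) → Set
ConflictFree {n} {k} c xs = ∃[ col ] length (filter (λ x → c x ≟ col) xs) ≡ 1

CFConnected : ∀ {n k} → Graph n → (Fin n → Fin k) → Set
CFConnected {n} G c = ∀ (u v : Fin n) → ∃[ xs ] (Path G u v xs × ConflictFree c xs)

-- G has a (not necessarily proper) conflict-free vertex-connected k-colouring.
CFColorable : ∀ {n} → Graph n → ℕ → Set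
CFColorable {n} G k = ∃[ c ] CFConnected {n} {k} G c

IsVcfc : ∀ {n} → Graph n → ℕ → Set
IsVcfc G k = CFColorable G k × (∀ j → j < k → ¬ CFColorable G j)

IsStar : ∀ {n} → Graph n → Set
IsStar {n} G = 2 ≤ n × ∃[ c ]
  (∀ (x y : Fin n) → (Adj G x y → (x ≢ y × (x ≡ c ⊎ y ≡ c))) ×
                     ((x ≢ y × (x ≡ c ⊎ y ≡ c)) → Adj G x y))

-- Colour each vertex by its distance from a vertex v of least eccentricity r;
-- this uses r + 1 colours. Between two vertices u and w, repeatedly step from
-- the one farther from v to a neighbour one step closer to v, until the two
-- descents meet. The meeting vertex is strictly closer to v than every other
-- vertex of the resulting path, so its colour occurs on the path exactly once.
-- For a star, one colour cannot suffice since a path joining two distinct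
-- vertices has at least two vertices.
module Submission where

open import Defs hiding (sym)
open import Data.Nat using (ℕ; zero; suc; pred; _+_; _≤_; _<_; z≤n; s≤s; s≤s⁻¹; _≤?_)
open import Data.Nat.Properties
open import Data.Fin using (Fin; fromℕ<) renaming (zero to fzero; suc to fsuc)
import Data.Fin as Fin
open import Data.Fin.Properties using (¬Fin0; any?; fromℕ<-injective)
open import Data.List using (List; []; _∷_; [_]; _++_; _∷ʳ_; length; filter)
open import Data.List.Properties using (length-++; ++-assoc; filter-++; filter-accept; filter-none; filter-all)
open import Data.List.Relation.Unary.All as All using (All; []; _∷_)
open import Data.List.Relation.Unary.All.Properties using (∷ʳ⁺)
open import Data.List.Relation.Unary.AllPairs using ([]; _∷_)
open import Data.List.Relation.Unary.Unique.Propositional using (Unique)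
open import Data.Product using (Σ-syntax; ∃-syntax; _×_; _,_; proj₁; proj₂)
open import Data.Sum using (_⊎_; inj₁; inj₂)
open import Function using (_∘_)
open import Relation.Nullary using (¬_; yes; no; contradiction)
open import Relation.Nullary.Decidable using (Dec; T?; _×-dec_)
open import Relation.Unary using (Pred; Decidable; ∁)
open import Relation.Binary.PropositionalEquality using (_≡_; _≢_; refl; sym; trans; cong; subst; ≢-sym; module ≡-Reasoning)

least-witness : ∀ {p} {P : Pred ℕ p} → Decidable P → ∀ {m} → P m →
                Σ[ d ∈ ℕ ] P d × (∀ {e} → P e → d ≤ e)
least-witness P? {zero} p = 0 , p , λ _ → z≤n
least-witness P? {suc m} p with P? 0
... | yes p₀ = 0 , p₀ , λ _ → z≤n
... | no ¬p₀ with least-witness (P? ∘ suc) p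
...   | d , pd , least = suc d , pd , λ { {zero} p₀ → contradiction p₀ ¬p₀ ; {suc e} pe → s≤s (least pe) }

length-∷ʳ : ∀ {a} {A : Set a} (xs : List A) (x : A) → length (xs ∷ʳ x) ≡ suc (length xs)
length-∷ʳ xs x = trans (length-++ xs) (+-comm (length xs) 1)

unique-∷ʳ : ∀ {a} {A : Set a} {xs : List A} {x : A} →
            Unique xs → All (_≢ x) xs → Unique (xs ∷ʳ x)
unique-∷ʳ [] [] = [] ∷ []
unique-∷ʳ (y∉ys ∷ ys) (y≢x ∷ ys≢x) = ∷ʳ⁺ y∉ys y≢x ∷ unique-∷ʳ ys ys≢x

length-filter≡1 : ∀ {a p} {A : Set a} {P : Pred A p} (P? : Decidable P) {xs z ys} →
                  All (∁ P) xs → P z → All (∁ P) ys → length (filter P? (xs ++ z ∷ ys)) ≡ 1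
length-filter≡1 P? {xs} {z} {ys} ¬xs pz ¬ys = begin
  length (filter P? (xs ++ z ∷ ys))            ≡⟨ cong length (filter-++ P? xs (z ∷ ys)) ⟩
  length (filter P? xs ++ filter P? (z ∷ ys))  ≡⟨ cong (λ l → length (l ++ _)) (filter-none P? ¬xs) ⟩
  length (filter P? (z ∷ ys))                  ≡⟨ cong length (filter-accept P? pz) ⟩
  suc (length (filter P? ys))                  ≡⟨ cong (suc ∘ length) (filter-none P? ¬ys) ⟩
  1                                            ∎
  where open ≡-Reasoning

module _ {n} {G : Graph n} where

  walk-∷ʳ : ∀ {a b c xs} → Walk G a b xs → Adj G b c → Walk G a c (xs ∷ʳ c)
  walk-∷ʳ here e′ = step e′ here
  walk-∷ʳ (step e w) e′ = step e (walk-∷ʳ w e′)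

  path-∷ʳ : ∀ {a b c xs} → Path G a b xs → Adj G b c → All (_≢ c) xs → Path G a c (xs ∷ʳ c)
  path-∷ʳ (w , u) e xs≢c = walk-∷ʳ w e , unique-∷ʳ u xs≢c

  adj⇒≢ : ∀ {a b} → Adj G a b → a ≢ b
  adj⇒≢ {a} e refl = irrefl G a e

  edge-path : ∀ {a b} → Adj G a b → Path G a b (a ∷ b ∷ [])
  edge-path e = step e here , (adj⇒≢ e ∷ []) ∷ [] ∷ []

  walk-≢⇒2≤length : ∀ {a b xs} → Walk G a b xs → a ≢ b → 2 ≤ length xs
  walk-≢⇒2≤length here a≢b = contradiction refl a≢b
  walk-≢⇒2≤length (step _ here) _ = s≤s (s≤s z≤n)
  walk-≢⇒2≤length (step _ (step _ _)) _ = s≤s (s≤s z≤n)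

  adj⇒IsDist-1 : ∀ {a b} → Adj G a b → IsDist G a b 1
  adj⇒IsDist-1 e = (_ , edge-path e , refl) , λ _ p → walk-≢⇒2≤length (proj₁ p) (adj⇒≢ e)

vcfc-minimal : ∀ {n} {G : Graph n} {k j} → IsVcfc G k → CFColorable G j → k ≤ j
vcfc-minimal (_ , fewer) cj = ≮⇒≥ (λ j<k → fewer _ j<k cj)

¬CFColorable-0 : ∀ {n} (G : Graph (suc n)) → ¬ CFColorable G 0
¬CFColorable-0 G (colour , _) = ¬Fin0 (colour fzero)

¬CFColorable-1 : ∀ {n} (G : Graph (suc (suc n))) → ¬ CFColorable G 1
¬CFColorable-1 G (colour , cf) with cf fzero (fsuc fzero)
... | xs , (walk , _) , c , once = 2≰1 (subst (2 ≤_) length≡1 (walk-≢⇒2≤length walk λ ()))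
  where
    Fin1-≡ : (i j : Fin 1) → i ≡ j
    Fin1-≡ fzero fzero = refl
    length≡1 : length xs ≡ 1
    length≡1 = trans (cong length (sym (filter-all (λ x → colour x Fin.≟ c)
                                          (All.universal (λ x → Fin1-≡ (colour x) c) xs))))
                     once
    2≰1 : ¬ 2 ≤ 1
    2≰1 (s≤s ())

module BreadthFirst {n} (G : Graph n) (root : Fin n) (connected : Connected G) where

  data Within : ℕ → Fin n → Set where
    start  : ∀ {d} → Within d root
    extend : ∀ {d x y} → Within d y → Adj G y x → Within (suc d) x

  within? : ∀ d x → Dec (Within d x)
  within? d x with x Fin.≟ root
  ... | yes refl = yes start
  within? zero x | no x≢root = no λ { start → x≢root refl }
  within? (suc d) x | no x≢root with any? (λ y → within? d y ×-dec T? (adj G y x))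
  ... | yes (y , wy , e) = yes (extend wy e)
  ... | no ∄y = no λ { start → x≢root refl ; (extend wy e) → ∄y (_ , wy , e) }

  within-0 : ∀ {x} → Within 0 x → x ≡ root
  within-0 start = refl

  within-inv : ∀ {d x} → Within d x → x ≢ root →
               Σ[ y ∈ Fin n ] Σ[ d′ ∈ ℕ ] d ≡ suc d′ × Within d′ y × Adj G y x
  within-inv start x≢root = contradiction refl x≢root
  within-inv (extend wy e) _ = _ , _ , refl , wy , e

  walk-within : ∀ {a x xs d} → Walk G a x xs → Within d a → Within (pred (length xs) + d) x
  walk-within here wa = wa
  walk-within (step e here) wa = extend wa e
  walk-within {x = x} {d = d} (step e w@(step _ _)) wa =
    subst (λ k → Within k x) (+-suc _ d) (walk-within w (extend wa e))

  private
    shallowest : ∀ x → Σ[ d ∈ ℕ ] Within d x × (∀ {e} → Within e x → d ≤ e)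
    shallowest x = least-witness (λ d → within? d x) (walk-within (proj₂ (connected root x)) (start {0}))

  depth : Fin n → ℕ
  depth x = proj₁ (shallowest x)

  depth-within : ∀ x → Within (depth x) x
  depth-within x = proj₁ (proj₂ (shallowest x))

  depth-least : ∀ {d x} → Within d x → depth x ≤ d
  depth-least {x = x} = proj₂ (proj₂ (shallowest x))

  depth-root : depth root ≡ 0
  depth-root = n≤0⇒n≡0 (depth-least (start {0}))

  depth≡0⇒root : ∀ x → depth x ≡ 0 → x ≡ root
  depth≡0⇒root x eq = within-0 (subst (λ d → Within d x) eq (depth-within x))

  depth≤root⇒root : ∀ x → depth x ≤ depth root → x ≡ root
  depth≤root⇒root x le = depth≡0⇒root x (n≤0⇒n≡0 (subst (depth x ≤_) depth-root le))

  depth-adjacent : ∀ {x y} → Adj G y x → depth x ≤ suc (depth y)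
  depth-adjacent e = depth-least (extend (depth-within _) e)

  parent : ∀ x → x ≢ root → Σ[ y ∈ Fin n ] Adj G x y × suc (depth y) ≡ depth x
  parent x x≢root with within-inv (depth-within x) x≢root
  ... | y , d , eq , wy , e =
    y , Graph.sym G y x e ,
    ≤-antisym (≤-trans (s≤s (depth-least wy)) (≤-reflexive (sym eq))) (depth-adjacent e)

  walk-length-bound : ∀ {x xs} → Walk G root x xs → suc (depth x) ≤ length xs
  walk-length-bound here = s≤s (depth-least (start {0}))
  walk-length-bound w@(step _ _) =
    s≤s (≤-trans (depth-least (walk-within w (start {0}))) (≤-reflexive (+-identityʳ _)))

  geodesic : ∀ k x → depth x ≡ k →
             Σ[ xs ∈ List (Fin n) ] Path G root x xs × length xs ≡ suc (depth x) ×
                                    All (λ y → depth y ≤ depth x) xs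
  geodesic zero x eq with depth≡0⇒root x eq
  ... | refl = [ root ] , (here , [] ∷ []) , cong suc (sym eq) , ≤-refl ∷ []
  geodesic (suc k) x eq with parent x (λ { refl → 0≢1+n (trans (sym depth-root) eq) })
  ... | y , e , 1+y≡x with geodesic k y (suc-injective (trans 1+y≡x eq))
  ...   | ys , path , len , below =
    ys ∷ʳ x , path-∷ʳ path (Graph.sym G x y e) (All.map ≢x below) ,
    trans (length-∷ʳ ys x) (cong suc (trans len 1+y≡x)) ,
    ∷ʳ⁺ (All.map (λ le → ≤-trans le (<⇒≤ y<x)) below) ≤-refl
    where
      y<x : depth y < depth x
      y<x = ≤-reflexive 1+y≡x
      ≢x : ∀ {t} → depth t ≤ depth y → t ≢ x
      ≢x le refl = <⇒≱ y<x le

  depth-isDist : ∀ x → IsDist G root x (depth x)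
  depth-isDist x with geodesic _ x refl
  ... | xs , path , len , _ = (xs , path , len) , λ _ p → walk-length-bound (proj₁ p)

  _≼_ : Fin n → Fin n → Set
  t ≼ x = t ≡ x ⊎ depth t < depth x

  -- `enclosed` is the invariant that keeps the path simple when it is extended at either end.
  record Valley (u w : Fin n) : Set where
    field
      left right  : List (Fin n)
      bottom      : Fin n
      path        : Path G u w (left ++ bottom ∷ right)
      enclosed    : All (λ t → t ≼ u ⊎ t ≼ w) (left ++ bottom ∷ right)
      left-above  : All (λ t → depth bottom < depth t) left
      right-above : All (λ t → depth bottom < depth t) right
      bottom≤u    : depth bottom ≤ depth u
      bottom≤w    : depth bottom ≤ depth w

  valley-refl : ∀ u → Valley u u
  valley-refl u = record
    { left = [] ; right = [] ; bottom = u
    ; path = here , [] ∷ []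
    ; enclosed = inj₁ (inj₁ refl) ∷ []
    ; left-above = [] ; right-above = []
    ; bottom≤u = ≤-refl ; bottom≤w = ≤-refl
    }

  valley-∷ : ∀ {u y w} → Adj G u y → suc (depth y) ≡ depth u → depth w ≤ depth u → u ≢ w →
             Valley y w → Valley u w
  valley-∷ {u} {y} {w} e 1+y≡u w≤u u≢w V = record
    { left = u ∷ left ; right = right ; bottom = bottom
    ; path = step e (proj₁ path) , All.map u∉ enclosed ∷ proj₂ path
    ; enclosed = inj₁ (inj₁ refl) ∷ All.map widen enclosed
    ; left-above = bottom<u ∷ left-above ; right-above = right-above
    ; bottom≤u = <⇒≤ bottom<u ; bottom≤w = bottom≤w
    }
    where
      open Valley V
      y<u : depth y < depth u
      y<u = ≤-reflexive 1+y≡u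
      bottom<u : depth bottom < depth u
      bottom<u = ≤-<-trans bottom≤u y<u
      u∉ : ∀ {t} → t ≼ y ⊎ t ≼ w → u ≢ t
      u∉ (inj₁ (inj₁ refl)) refl = <-irrefl refl y<u
      u∉ (inj₁ (inj₂ t<y)) refl = <-asym t<y y<u
      u∉ (inj₂ (inj₁ refl)) refl = u≢w refl
      u∉ (inj₂ (inj₂ t<w)) refl = <⇒≱ t<w w≤u
      widen : ∀ {t} → t ≼ y ⊎ t ≼ w → t ≼ u ⊎ t ≼ w
      widen (inj₁ (inj₁ refl)) = inj₁ (inj₂ y<u)
      widen (inj₁ (inj₂ t<y)) = inj₁ (inj₂ (<-trans t<y y<u))
      widen (inj₂ t≼w) = inj₂ t≼w

  valley-∷ʳ : ∀ {u y w} → Adj G y w → suc (depth y) ≡ depth w → depth u < depth w →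
              Valley u y → Valley u w
  valley-∷ʳ {u} {y} {w} e 1+y≡w u<w V = record
    { left = left ; right = right ∷ʳ w ; bottom = bottom
    ; path = subst (Path G u w) assoc (path-∷ʳ path e (All.map ∉w enclosed))
    ; enclosed = subst (All _) assoc (∷ʳ⁺ (All.map widen enclosed) (inj₂ (inj₁ refl)))
    ; left-above = left-above ; right-above = ∷ʳ⁺ right-above bottom<w
    ; bottom≤u = bottom≤u ; bottom≤w = <⇒≤ bottom<w
    }
    where
      open Valley V
      assoc : (left ++ bottom ∷ right) ∷ʳ w ≡ left ++ bottom ∷ right ∷ʳ w
      assoc = ++-assoc left (bottom ∷ right) [ w ]
      y<w : depth y < depth w
      y<w = ≤-reflexive 1+y≡w
      bottom<w : depth bottom < depth w
      bottom<w = ≤-<-trans bottom≤w y<w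
      ∉w : ∀ {t} → t ≼ u ⊎ t ≼ y → t ≢ w
      ∉w (inj₁ (inj₁ refl)) refl = <-irrefl refl u<w
      ∉w (inj₁ (inj₂ t<u)) refl = <-asym t<u u<w
      ∉w (inj₂ (inj₁ refl)) refl = <-irrefl refl y<w
      ∉w (inj₂ (inj₂ t<y)) refl = <-asym t<y y<w
      widen : ∀ {t} → t ≼ u ⊎ t ≼ y → t ≼ u ⊎ t ≼ w
      widen (inj₁ t≼u) = inj₁ t≼u
      widen (inj₂ (inj₁ refl)) = inj₂ (inj₂ y<w)
      widen (inj₂ (inj₂ t<y)) = inj₂ (inj₂ (<-trans t<y y<w))

  valley : ∀ k u w → depth u + depth w ≡ k → Valley u w
  valley zero u w eq
    with depth≡0⇒root u (m+n≡0⇒m≡0 (depth u) eq) | depth≡0⇒root w (m+n≡0⇒n≡0 (depth u) eq)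
  ... | refl | refl = valley-refl root
  valley (suc k) u w eq with u Fin.≟ w | depth w ≤? depth u
  ... | yes refl | _ = valley-refl u
  ... | no u≢w | yes w≤u with parent u (λ { refl → u≢w (sym (depth≤root⇒root w w≤u)) })
  ...   | y , e , 1+y≡u =
    valley-∷ e 1+y≡u w≤u u≢w (valley k y w (suc-injective (trans (cong (_+ depth w) 1+y≡u) eq)))
  valley (suc k) u w eq | no u≢w | no w≰u
    with parent w (λ { refl → n≮0 (subst (depth u <_) depth-root (≰⇒> w≰u)) })
  ...   | y , e , 1+y≡w =
    valley-∷ʳ (Graph.sym G w y e) 1+y≡w (≰⇒> w≰u)
      (valley k u y (suc-injective (trans (sym (+-suc (depth u) (depth y)))
                                          (trans (cong (depth u +_) 1+y≡w) eq))))

  cfColorable : ∀ r → (∀ x d → IsDist G root x d → d ≤ r) → CFColorable G (suc r)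
  cfColorable r ecc = colour , cf
    where
      depth<1+r : ∀ x → depth x < suc r
      depth<1+r x = s≤s (ecc x (depth x) (depth-isDist x))
      colour : Fin n → Fin (suc r)
      colour x = fromℕ< (depth<1+r x)
      deeper⇒recoloured : ∀ {t z} → depth z < depth t → colour t ≢ colour z
      deeper⇒recoloured {t} {z} z<t eq =
        <⇒≢ z<t (sym (fromℕ<-injective (depth t) (depth z) (depth<1+r t) (depth<1+r z) eq))
      cf : CFConnected G colour
      cf u w = left ++ bottom ∷ right , path , colour bottom ,
               length-filter≡1 (λ x → colour x Fin.≟ colour bottom)
                 (All.map deeper⇒recoloured left-above) refl (All.map deeper⇒recoloured right-above)
        where open Valley (valley _ u w refl)

vcfc≤radius+1 : ∀ {n} {G : Graph n} {r k} → Connected G → IsRadius G r → IsVcfc G k → k ≤ suc r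
vcfc≤radius+1 {G = G} {r} connected ((centre , ecc , _) , _) vcfc =
  vcfc-minimal vcfc (BreadthFirst.cfColorable G centre connected r ecc)

eccentricity-positive : ∀ {n} {G : Graph n} {x y e} → Connected G → x ≢ y → IsEcc G x e → 1 ≤ e
eccentricity-positive {G = G} {x} {y} conn x≢y (bounded , _) =
  ≤-trans (n≢0⇒n>0 (x≢y ∘ sym ∘ depth≡0⇒root y)) (bounded y (depth y) (depth-isDist y))
  where open BreadthFirst G x conn

∃≢ : ∀ {m} (x : Fin (suc (suc m))) → ∃[ y ] x ≢ y
∃≢ fzero = fsuc fzero , λ ()
∃≢ (fsuc _) = fzero , λ ()

module Dominating {n} (G : Graph n) (c : Fin n) (spoke : ∀ x → x ≢ c → Adj G c x) where

  connected : Connected G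
  connected u w with u Fin.≟ c | w Fin.≟ c
  ... | yes refl | yes refl = [ c ] , here
  ... | yes refl | no w≢c = _ , step (spoke w w≢c) here
  ... | no u≢c | yes refl = _ , step (Graph.sym G c u (spoke u u≢c)) here
  ... | no u≢c | no w≢c = _ , step (Graph.sym G c u (spoke u u≢c)) (step (spoke w w≢c) here)

  centre-eccentricity : ∀ u d → IsDist G c u d → d ≤ 1
  centre-eccentricity u d (_ , shortest) with u Fin.≟ c
  ... | yes refl = ≤-trans (s≤s⁻¹ (shortest [ c ] (here , [] ∷ []))) z≤n
  ... | no u≢c = s≤s⁻¹ (shortest _ (edge-path (spoke u u≢c)))

star-vcfc-radius : ∀ n (T : Graph n) → IsStar T → IsVcfc T 2 × IsRadius T 1
star-vcfc-radius (suc zero) T (s≤s () , _)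
star-vcfc-radius (suc (suc m)) T (_ , c , star) =
  (cfColorable 1 centre-eccentricity , fewer) ,
  (c , centre-eccentricity , leaf , adj⇒IsDist-1 (spoke leaf (≢-sym c≢leaf))) ,
  λ v e ecc → eccentricity-positive connected (proj₂ (∃≢ v)) ecc
  where
    spoke : ∀ x → x ≢ c → Adj T c x
    spoke x x≢c = proj₂ (star c x) (≢-sym x≢c , inj₁ refl)
    open Dominating T c spoke
    open BreadthFirst T c connected using (cfColorable)
    leaf : Fin (suc (suc m))
    leaf = proj₁ (∃≢ c)
    c≢leaf : c ≢ leaf
    c≢leaf = proj₂ (∃≢ c)
    fewer : ∀ j → j < 2 → ¬ CFColorable T j
    fewer zero _ = ¬CFColorable-0 T
    fewer (suc zero) _ = ¬CFColorable-1 T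
    fewer (suc (suc _)) (s≤s (s≤s ()))

theorem7 : (∀ (n : ℕ) (T : Graph n) → IsTree T →
               ∀ (r : ℕ) → IsRadius T r → ∀ (k : ℕ) → IsVcfc T k → k ≤ suc r)
             × (∀ (n : ℕ) (T : Graph n) → IsStar T → IsVcfc T 2 × IsRadius T 1)
theorem7 = (λ _ _ (_ , connected , _) _ radius _ → vcfc≤radius+1 connected radius) ,
           star-vcfc-radius
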